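{- Let $t\ge 2$ and $k\ge 2t$ be integers, and let $m_0,m_1,\dots,m_{t-2}$ be non-negative integers with $m_0+m_1+\dots+m_{t-2}=k-2t$. Suppose that for every $0\le i\le t-3$ we are given a finite sequence consisting of exactly $m_i$ entries equal to $i$ and $m_{i+1}$ entries equal to $i+1$, whose first entry is $i$. Then there exists a unique permitted sequence with parameters $k-2t$ and $t$ such that, for every $0\le i\le t-3$, the subsequence of its entries equal to $i$ or $i+1$ is exactly the given sequence.
   Context: A sequence $[\gamma_1,\dots,\gamma_{k-2t}]$ of non-negative integers is permitted with parameters $k-2t$ and $t$ if (i) $\gamma_1=0$, (ii) $\gamma_{i+1}\le\gamma_i+1$ for all $i$, and (iii) $\gamma_i\le t-2$ for all $i$. -}

module Defs where

open import Data.Nat using (ℕ; zero; suc; _≤_; _≟_; _+_; _*_; _∸_)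
open import Data.List using (List; []; _∷_; length; filter; map; upTo)
open import Data.Nat.ListAction using (sum)
open import Data.List.Relation.Unary.All using (All)
open import Data.List.Relation.Unary.Linked using (Linked)
open import Data.Sum using (_⊎_)
open import Data.Product using (_×_)
open import Data.Unit using (⊤)
open import Relation.Binary.PropositionalEquality using (_≡_)
open import Relation.Nullary.Decidable using (_⊎-dec_)
open import Relation.Unary using (Decidable)

FirstIs : ℕ → List ℕ → Set
FirstIs a []      = ⊤
FirstIs a (x ∷ _) = x ≡ a

StepOK : ℕ → ℕ → Set
StepOK x y = y ≤ suc x

Permitted : ℕ → ℕ → List ℕ → Set
Permitted len t γ =
  length γ ≡ len × FirstIs 0 γ × Linked StepOK γ × All (λ x → x ≤ t ∸ 2) γ

InPair : ℕ → ℕ → Set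
InPair i x = x ≡ i ⊎ x ≡ suc i

inPair? : (i : ℕ) → Decidable (InPair i)
inPair? i x = (x ≟ i) ⊎-dec (x ≟ suc i)

restrict : ℕ → List ℕ → List ℕ
restrict i γ = filter (inPair? i) γ

countOf : ℕ → List ℕ → ℕ
countOf a xs = length (filter (_≟ a) xs)

sumBelow : ℕ → (ℕ → ℕ) → ℕ
sumBelow n m = sum (map m (upTo n))

-- Uniqueness: if two sequences climbing by steps of at most one started at x < y,
-- their restrictions to {y - 1, y} would differ, the first beginning with y - 1 and
-- the second with y; so equal restrictions force equal first entries, and one
-- proceeds entry by entry.
-- Existence: build the sequence one value at a time.  The given sequence on
-- {j, j + 1} is j followed by a run of j + 1's, repeated; inserting these runs
-- right after the successive occurrences of j in the sequence built on {0, …, j}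
-- (which has exactly m_j of them) keeps all the earlier restrictions and the step
-- condition, and produces the required restriction to {j, j + 1}.

module Submission where

open import Defs
open import Level using (0ℓ)
open import Function using (_∘_)
open import Data.Nat using (ℕ; zero; suc; _≤_; _<_; _+_; _*_; _∸_; _≟_; z≤n; s≤s)
open import Data.Nat.Properties
open import Algebra.Properties.CommutativeSemigroup +-commutativeSemigroup using (x∙yz≈y∙xz)
open import Data.Nat.ListAction using (sum)
open import Data.Nat.ListAction.Properties using (sum-++)
open import Data.List using (List; []; _∷_; _++_; [_]; replicate; length; filter; map; upTo)
open import Data.List.Properties
  using (filter-accept; filter-reject; filter-++; filter-all; filter-none;
         length-++; length-replicate; map-++; ∷-injectiveʳ; upTo-∷ʳ)
open import Data.List.Relation.Unary.All using (All; []; _∷_) renaming (map to All-map)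
open import Data.List.Relation.Unary.All.Properties using (replicate⁺; ++⁺)
open import Data.List.Relation.Unary.Linked using (Linked; [-]; _∷_; tail)
open import Data.Product using (∃; ∃₂; ∃!; _×_; _,_; proj₁; proj₂)
open import Data.Sum using (inj₁; inj₂)
open import Data.Unit using (tt)
open import Data.Empty using (⊥-elim)
open import Relation.Nullary using (¬_; yes; no)
open import Relation.Unary using (Pred; Decidable)
open import Relation.Binary.Definitions using (tri<; tri≈; tri>)
open import Relation.Binary.PropositionalEquality
  using (_≡_; _≢_; refl; sym; trans; cong; cong₂; subst; module ≡-Reasoning)

module _ {P : Pred ℕ 0ℓ} (P? : Decidable P) where

  filter-∷-cong : ∀ x {xs ys} → filter P? xs ≡ filter P? ys → filter P? (x ∷ xs) ≡ filter P? (x ∷ ys)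
  filter-∷-cong x eq with P? x
  ... | yes _ = cong (x ∷_) eq
  ... | no  _ = eq

  filter-∷-cancel : ∀ x {xs ys} → filter P? (x ∷ xs) ≡ filter P? (x ∷ ys) → filter P? xs ≡ filter P? ys
  filter-∷-cancel x eq with P? x
  ... | yes _ = ∷-injectiveʳ eq
  ... | no  _ = eq

  filter-replicate-++-accept : ∀ n {y} xs → P y →
    filter P? (replicate n y ++ xs) ≡ replicate n y ++ filter P? xs
  filter-replicate-++-accept n xs py =
    trans (filter-++ P? (replicate n _) xs) (cong (_++ filter P? xs) (filter-all P? (replicate⁺ n py)))

  filter-replicate-++-reject : ∀ n {y} xs → ¬ P y →
    filter P? (replicate n y ++ xs) ≡ filter P? xs
  filter-replicate-++-reject n xs ¬py =
    trans (filter-++ P? (replicate n _) xs) (cong (_++ filter P? xs) (filter-none P? (replicate⁺ n ¬py)))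

countOf-∷-≡ : ∀ {a x} xs → x ≡ a → countOf a (x ∷ xs) ≡ suc (countOf a xs)
countOf-∷-≡ {a} xs x≡a = cong length (filter-accept (_≟ a) {xs = xs} x≡a)

countOf-∷-≢ : ∀ {a x} xs → x ≢ a → countOf a (x ∷ xs) ≡ countOf a xs
countOf-∷-≢ {a} xs x≢a = cong length (filter-reject (_≟ a) {xs = xs} x≢a)

countOf-replicate : ∀ n {a} → countOf a (replicate n a) ≡ n
countOf-replicate n {a} = trans (cong length (filter-all (_≟ a) (replicate⁺ n refl))) (length-replicate n)

countOf-replicate-++-≡ : ∀ n {a} xs → countOf a (replicate n a ++ xs) ≡ n + countOf a xs
countOf-replicate-++-≡ zero    xs = refl
countOf-replicate-++-≡ (suc n) xs =
  trans (countOf-∷-≡ (replicate n _ ++ xs) refl) (cong suc (countOf-replicate-++-≡ n xs))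

countOf-replicate-++-≢ : ∀ n {a b} xs → b ≢ a → countOf a (replicate n b ++ xs) ≡ countOf a xs
countOf-replicate-++-≢ n {a} xs b≢a = cong length (filter-replicate-++-reject (_≟ a) n xs b≢a)

¬InPair-< : ∀ {i x} → x < i → ¬ InPair i x
¬InPair-< x<i (inj₁ refl) = <-irrefl refl x<i
¬InPair-< x<i (inj₂ refl) = <-asym x<i (n<1+n _)

¬InPair-> : ∀ {i x} → suc i < x → ¬ InPair i x
¬InPair-> 1+i<x (inj₁ refl) = <-asym 1+i<x (n<1+n _)
¬InPair-> 1+i<x (inj₂ refl) = <-irrefl refl 1+i<x

filter-suc-restrict : ∀ j xs → filter (_≟ suc j) (restrict j xs) ≡ filter (_≟ suc j) xs
filter-suc-restrict j [] = refl
filter-suc-restrict j (x ∷ xs) with inPair? j x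
... | yes jx  = trans (cong (filter (_≟ suc j)) (filter-accept (inPair? j) jx))
                      (filter-∷-cong (_≟ suc j) x (filter-suc-restrict j xs))
... | no  ¬jx = trans (cong (filter (_≟ suc j)) (filter-reject (inPair? j) ¬jx))
                      (trans (filter-suc-restrict j xs) (sym (filter-reject (_≟ suc j) (¬jx ∘ inj₂))))

restrict-≡[] : ∀ {j} xs → All (_≤ j) xs → countOf j xs ≡ 0 → restrict j xs ≡ []
restrict-≡[] []       _          _ = refl
restrict-≡[] {j} (x ∷ xs) (x≤j ∷ b) c with x ≟ j
... | yes x≡j = ⊥-elim (1+n≢0 (trans (sym (countOf-∷-≡ xs x≡j)) c))
... | no  x≢j = trans (filter-reject (inPair? j) (¬InPair-< (≤∧≢⇒< x≤j x≢j)))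
                      (restrict-≡[] xs b (trans (sym (countOf-∷-≢ xs x≢j)) c))

Linked-head-≤ : ∀ {x y xs} → x ≤ y → Linked StepOK (x ∷ xs) → Linked StepOK (y ∷ xs)
Linked-head-≤ x≤y [-]     = [-]
Linked-head-≤ x≤y (r ∷ l) = ≤-trans r (s≤s x≤y) ∷ l

Linked-replicate : ∀ n {x} → Linked StepOK (x ∷ replicate n x)
Linked-replicate zero    = [-]
Linked-replicate (suc n) = n≤1+n _ ∷ Linked-replicate n

Linked-replicate-++ : ∀ n {x y xs} → x ≤ y → y ≤ suc x →
  Linked StepOK (x ∷ xs) → Linked StepOK (x ∷ replicate n y ++ xs)
Linked-replicate-++ zero    _   _     l = l
Linked-replicate-++ (suc n) x≤y y≤1+x l =
  y≤1+x ∷ Linked-replicate-++ n ≤-refl (n≤1+n _) (Linked-head-≤ x≤y l)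

FirstIs-replicate : ∀ n {a} → FirstIs a (replicate n a)
FirstIs-replicate zero    = tt
FirstIs-replicate (suc n) = refl

-- A sequence climbing by steps of at most one cannot reach i + 1 without passing through i.
FirstIs-restrict : ∀ {i x xs} → x ≤ i → Linked StepOK (x ∷ xs) → FirstIs i (restrict i (x ∷ xs))
FirstIs-restrict {i} {x} {xs} x≤i l with inPair? i x
... | yes (inj₁ x≡i) = subst (FirstIs i) (sym (filter-accept (inPair? i) (inj₁ x≡i))) x≡i
... | yes (inj₂ refl) = ⊥-elim (1+n≰n x≤i)
... | no ¬ix = subst (FirstIs i) (sym (filter-reject (inPair? i) ¬ix)) (FirstIs-restrict-tail l)
  where
  FirstIs-restrict-tail : Linked StepOK (x ∷ xs) → FirstIs i (restrict i xs)
  FirstIs-restrict-tail [-]     = tt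
  FirstIs-restrict-tail (r ∷ l) = FirstIs-restrict (≤-trans r (≤∧≢⇒< x≤i (¬ix ∘ inj₁))) l

restrict-separates-heads : ∀ {T x y xs ys} → x < y → y ≤ T → Linked StepOK (x ∷ xs) →
  ∃ λ i → i < T × restrict i (x ∷ xs) ≢ restrict i (y ∷ ys)
restrict-separates-heads {y = suc i} (s≤s x≤i) 1+i≤T l = i , 1+i≤T , λ eq →
  1+n≢n (subst (FirstIs i) (trans eq (filter-accept (inPair? i) (inj₂ refl))) (FirstIs-restrict x≤i l))

head-determined : ∀ T {x y xs ys} → Linked StepOK (x ∷ xs) → Linked StepOK (y ∷ ys) → x ≤ T → y ≤ T →
  (∀ i → i < T → restrict i (x ∷ xs) ≡ restrict i (y ∷ ys)) → x ≡ y
head-determined T {x} {y} lx ly x≤T y≤T R with <-cmp x y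
... | tri< x<y _ _ = let i , i<T , ≢ = restrict-separates-heads x<y y≤T lx in ⊥-elim (≢ (R i i<T))
... | tri≈ _ x≡y _ = x≡y
... | tri> _ _ y<x = let i , i<T , ≢ = restrict-separates-heads y<x x≤T ly in ⊥-elim (≢ (sym (R i i<T)))

restrict-injective : ∀ T {xs ys} → Linked StepOK xs → Linked StepOK ys → All (_≤ T) xs → All (_≤ T) ys →
  length xs ≡ length ys → (∀ i → i < T → restrict i xs ≡ restrict i ys) → xs ≡ ys
restrict-injective T {[]}    {[]}    _  _  _            _            _   _ = refl
restrict-injective T {x ∷ xs} {y ∷ ys} lx ly (x≤T ∷ bx) (y≤T ∷ by) len R
  with head-determined T lx ly x≤T y≤T R
... | refl = cong (x ∷_) (restrict-injective T (tail lx) (tail ly) bx by (suc-injective len)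
                            (λ i i<T → filter-∷-cancel (inPair? i) x (R i i<T)))

runs : ℕ → List ℕ → List ℕ
runs j []       = []
runs j (a ∷ as) = j ∷ replicate a (suc j) ++ runs j as

runs-decompose : ∀ j {xs} → All (InPair j) xs → ∃₂ λ n as → xs ≡ replicate n (suc j) ++ runs j as
runs-decompose j [] = 0 , [] , refl
runs-decompose j (inj₁ refl ∷ ps) with runs-decompose j ps
... | n , as , eq = 0 , n ∷ as , cong (j ∷_) eq
runs-decompose j (inj₂ refl ∷ ps) with runs-decompose j ps
... | n , as , eq = suc n , as , cong (suc j ∷_) eq

runs-complete : ∀ j {xs} → All (InPair j) xs → FirstIs j xs → ∃ λ as → xs ≡ runs j as
runs-complete j ps first with runs-decompose j ps
... | zero  , as , eq   = as , eq
... | suc n , as , refl = ⊥-elim (1+n≢n first)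

countOf-runs : ∀ j as → countOf j (runs j as) ≡ length as
countOf-runs j []       = refl
countOf-runs j (a ∷ as) = begin
  countOf j (j ∷ replicate a (suc j) ++ runs j as)
    ≡⟨ countOf-∷-≡ {j} (replicate a (suc j) ++ runs j as) refl ⟩
  suc (countOf j (replicate a (suc j) ++ runs j as)) ≡⟨ cong suc (countOf-replicate-++-≢ a (runs j as) 1+n≢n) ⟩
  suc (countOf j (runs j as))                        ≡⟨ cong suc (countOf-runs j as) ⟩
  suc (length as)                                    ∎
  where open ≡-Reasoning

countOf-suc-runs : ∀ j as → countOf (suc j) (runs j as) ≡ sum as
countOf-suc-runs j []       = refl
countOf-suc-runs j (a ∷ as) = begin
  countOf (suc j) (j ∷ replicate a (suc j) ++ runs j as)
    ≡⟨ countOf-∷-≢ {suc j} (replicate a (suc j) ++ runs j as) (1+n≢n ∘ sym) ⟩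
  countOf (suc j) (replicate a (suc j) ++ runs j as)     ≡⟨ countOf-replicate-++-≡ a (runs j as) ⟩
  a + countOf (suc j) (runs j as)                         ≡⟨ cong (a +_) (countOf-suc-runs j as) ⟩
  a + sum as                                              ∎
  where open ≡-Reasoning

insertRuns : ℕ → List ℕ → List ℕ → List ℕ
insertRuns j xs       []       = xs
insertRuns j []       (_ ∷ _)  = []
insertRuns j (x ∷ xs) (a ∷ as) with x ≟ j
... | yes _ = x ∷ replicate a (suc j) ++ insertRuns j xs as
... | no  _ = x ∷ insertRuns j xs (a ∷ as)

insertRuns-restrict-below : ∀ {i j} → i < j → ∀ xs as → restrict i (insertRuns j xs as) ≡ restrict i xs
insertRuns-restrict-below i<j xs       []       = refl
insertRuns-restrict-below i<j []       (_ ∷ _)  = refl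
insertRuns-restrict-below {i} {j} i<j (x ∷ xs) (a ∷ as) with x ≟ j
... | yes _ = filter-∷-cong (inPair? i) x
                (trans (filter-replicate-++-reject (inPair? i) a _ (¬InPair-> (s≤s i<j)))
                       (insertRuns-restrict-below i<j xs as))
... | no  _ = filter-∷-cong (inPair? i) x (insertRuns-restrict-below i<j xs (a ∷ as))

insertRuns-restrict : ∀ {j} xs as → All (_≤ j) xs → countOf j xs ≡ length as →
  restrict j (insertRuns j xs as) ≡ runs j as
insertRuns-restrict xs       []       b         c = restrict-≡[] xs b c
insertRuns-restrict []       (_ ∷ _)  _         ()
insertRuns-restrict {j} (x ∷ xs) (a ∷ as) (x≤j ∷ b) c with x ≟ j
... | yes refl = trans (filter-accept (inPair? j) (inj₁ refl))
                   (cong (j ∷_) (trans (filter-replicate-++-accept (inPair? j) a _ (inj₂ refl))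
                     (cong (replicate a (suc j) ++_)
                       (insertRuns-restrict xs as b (suc-injective (trans (sym (countOf-∷-≡ xs refl)) c))))))
... | no  x≢j = trans (filter-reject (inPair? j) (¬InPair-< (≤∧≢⇒< x≤j x≢j)))
                  (insertRuns-restrict xs (a ∷ as) b (trans (sym (countOf-∷-≢ xs x≢j)) c))

insertRuns-length : ∀ {j} xs as → countOf j xs ≡ length as → length (insertRuns j xs as) ≡ length xs + sum as
insertRuns-length xs       []       _ = sym (+-identityʳ (length xs))
insertRuns-length []       (_ ∷ _)  ()
insertRuns-length {j} (x ∷ xs) (a ∷ as) c with x ≟ j
... | yes x≡j = cong suc (begin
  length (replicate a (suc j) ++ insertRuns j xs as)      ≡⟨ length-++ (replicate a (suc j)) ⟩
  length (replicate a (suc j)) + length (insertRuns j xs as)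
    ≡⟨ cong₂ _+_ (length-replicate a)
                 (insertRuns-length xs as (suc-injective (trans (sym (countOf-∷-≡ xs x≡j)) c))) ⟩
  a + (length xs + sum as)                                ≡⟨ x∙yz≈y∙xz a (length xs) (sum as) ⟩
  length xs + (a + sum as)                                ∎)
  where open ≡-Reasoning
... | no  x≢j = cong suc (insertRuns-length xs (a ∷ as) (trans (sym (countOf-∷-≢ xs x≢j)) c))

insertRuns-bounded : ∀ {j} xs as → All (_≤ j) xs → All (_≤ suc j) (insertRuns j xs as)
insertRuns-bounded xs       []       b         = All-map m≤n⇒m≤1+n b
insertRuns-bounded []       (_ ∷ _)  _         = []
insertRuns-bounded {j} (x ∷ xs) (a ∷ as) (x≤j ∷ b) with x ≟ j
... | yes _ = m≤n⇒m≤1+n x≤j ∷ ++⁺ (replicate⁺ a ≤-refl) (insertRuns-bounded xs as b)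
... | no  _ = m≤n⇒m≤1+n x≤j ∷ insertRuns-bounded xs (a ∷ as) b

insertRuns-Linked : ∀ {j p} xs as → Linked StepOK (p ∷ xs) → Linked StepOK (p ∷ insertRuns j xs as)
insertRuns-Linked xs       []       l       = l
insertRuns-Linked []       (_ ∷ _)  l       = [-]
insertRuns-Linked {j} (x ∷ xs) (a ∷ as) (r ∷ l) with x ≟ j
... | yes refl = r ∷ Linked-replicate-++ a (n≤1+n j) ≤-refl (insertRuns-Linked xs as l)
... | no  _    = r ∷ insertRuns-Linked xs (a ∷ as) l

insertRuns-FirstIs : ∀ {i j} xs as → FirstIs i xs → FirstIs i (insertRuns j xs as)
insertRuns-FirstIs xs       []       first = first
insertRuns-FirstIs []       (_ ∷ _)  first = tt
insertRuns-FirstIs {j = j} (x ∷ xs) (a ∷ as) first with x ≟ j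
... | yes _ = first
... | no  _ = first

sumBelow-suc : ∀ n m → sumBelow (suc n) m ≡ sumBelow n m + m n
sumBelow-suc n m = begin
  sum (map m (upTo (suc n)))          ≡⟨ cong (sum ∘ map m) (sym (upTo-∷ʳ n)) ⟩
  sum (map m (upTo n ++ [ n ]))       ≡⟨ cong sum (map-++ m (upTo n) [ n ]) ⟩
  sum (map m (upTo n) ++ [ m n ])     ≡⟨ sum-++ (map m (upTo n)) [ m n ] ⟩
  sumBelow n m + (m n + 0)            ≡⟨ cong (sumBelow n m +_) (+-identityʳ (m n)) ⟩
  sumBelow n m + m n                  ∎
  where open ≡-Reasoning

module Construction (T : ℕ) (m : ℕ → ℕ) (s : ℕ → List ℕ)
  (s-spec : ∀ i → i < T → All (InPair i) (s i) × countOf i (s i) ≡ m i ×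
                          countOf (suc i) (s i) ≡ m (suc i) × FirstIs i (s i)) where

  record Stage (n : ℕ) (γ : List ℕ) : Set where
    field
      bounded     : All (_≤ n) γ
      linked      : Linked StepOK (0 ∷ γ)
      starts-at-0 : FirstIs 0 γ
      length≡     : length γ ≡ sumBelow (suc n) m
      countOf-top : countOf n γ ≡ m n
      restricts   : ∀ i → i < n → restrict i γ ≡ s i

  stage : ∀ n → n ≤ T → ∃ (Stage n)
  stage zero _ = replicate (m 0) 0 , record
    { bounded     = replicate⁺ (m 0) z≤n
    ; linked      = Linked-replicate (m 0)
    ; starts-at-0 = FirstIs-replicate (m 0)
    ; length≡     = trans (length-replicate (m 0)) (sym (+-identityʳ (m 0)))
    ; countOf-top = countOf-replicate (m 0)
    ; restricts   = λ _ () }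
  stage (suc n) 1+n≤T with s-spec n 1+n≤T | stage n (<⇒≤ 1+n≤T)
  ... | s-pairs , s-count , s-count-suc , s-first | γ , st with runs-complete n s-pairs s-first
  ... | as , s≡runs = insertRuns n γ as , record
    { bounded     = insertRuns-bounded γ as bounded
    ; linked      = insertRuns-Linked γ as linked
    ; starts-at-0 = insertRuns-FirstIs γ as starts-at-0
    ; length≡     = begin
        length (insertRuns n γ as)     ≡⟨ insertRuns-length γ as countOf-γ ⟩
        length γ + sum as              ≡⟨ cong₂ _+_ length≡ sum-runs ⟩
        sumBelow (suc n) m + m (suc n) ≡⟨ sym (sumBelow-suc (suc n) m) ⟩
        sumBelow (suc (suc n)) m       ∎
    ; countOf-top = begin
        countOf (suc n) (insertRuns n γ as)
          ≡⟨ cong length (sym (filter-suc-restrict n (insertRuns n γ as))) ⟩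
        countOf (suc n) (restrict n (insertRuns n γ as))   ≡⟨ cong (countOf (suc n)) restrict-top ⟩
        countOf (suc n) (s n)                              ≡⟨ s-count-suc ⟩
        m (suc n)                                          ∎
    ; restricts   = restricts-below-suc }
    where
    open Stage st
    open ≡-Reasoning

    countOf-γ : countOf n γ ≡ length as
    countOf-γ = begin
      countOf n γ           ≡⟨ countOf-top ⟩
      m n                   ≡⟨ sym s-count ⟩
      countOf n (s n)       ≡⟨ cong (countOf n) s≡runs ⟩
      countOf n (runs n as) ≡⟨ countOf-runs n as ⟩
      length as             ∎

    sum-runs : sum as ≡ m (suc n)
    sum-runs = begin
      sum as                      ≡⟨ sym (countOf-suc-runs n as) ⟩
      countOf (suc n) (runs n as) ≡⟨ cong (countOf (suc n)) (sym s≡runs) ⟩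
      countOf (suc n) (s n)       ≡⟨ s-count-suc ⟩
      m (suc n)                   ∎

    restrict-top : restrict n (insertRuns n γ as) ≡ s n
    restrict-top = trans (insertRuns-restrict γ as bounded countOf-γ) (sym s≡runs)

    restricts-below-suc : ∀ i → i < suc n → restrict i (insertRuns n γ as) ≡ s i
    restricts-below-suc i i<1+n with m<1+n⇒m<n∨m≡n i<1+n
    ... | inj₁ i<n  = trans (insertRuns-restrict-below i<n γ as) (restricts i i<n)
    ... | inj₂ refl = restrict-top

mainTheorem10 : (t k : ℕ) → 2 ≤ t → 2 * t ≤ k →
  (m : ℕ → ℕ) → sumBelow (t ∸ 1) m ≡ k ∸ 2 * t →
  (s : ℕ → List ℕ) →
  (∀ i → i + 3 ≤ t →
    All (InPair i) (s i) × countOf i (s i) ≡ m i ×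
    countOf (suc i) (s i) ≡ m (suc i) × FirstIs i (s i)) →
  ∃! _≡_ (λ γ → Permitted (k ∸ 2 * t) t γ ×
    (∀ i → i + 3 ≤ t → restrict i γ ≡ s i))
mainTheorem10 (suc (suc T)) k (s≤s (s≤s z≤n)) _ m sumBelow≡ s s-spec =
  γ , ((length-γ , starts-at-0 , tail linked , bounded) , λ i i+3≤t → restricts i (+3≤⇒< i+3≤t)) ,
  λ { ((length-δ , _ , linked-δ , bounded-δ) , restricts-δ) →
        restrict-injective T (tail linked) linked-δ bounded bounded-δ (trans length-γ (sym length-δ))
          (λ i i<T → trans (restricts i i<T) (sym (restricts-δ i (<⇒+3≤ i<T)))) }
  where
  <⇒+3≤ : ∀ {i} → i < T → i + 3 ≤ suc (suc T)
  <⇒+3≤ {i} i<T = subst (_≤ suc (suc T)) (+-comm 3 i) (s≤s (s≤s i<T))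

  +3≤⇒< : ∀ {i} → i + 3 ≤ suc (suc T) → i < T
  +3≤⇒< {i} i+3≤t = ≤-pred (≤-pred (subst (_≤ suc (suc T)) (+-comm i 3) i+3≤t))

  open Construction T m s (λ i i<T → s-spec i (<⇒+3≤ i<T))
  built : ∃ (Stage T)
  built = stage T ≤-refl

  γ : List ℕ
  γ = proj₁ built
  open Stage (proj₂ built)

  length-γ : length γ ≡ k ∸ 2 * suc (suc T)
  length-γ = trans length≡ sumBelow≡
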